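{- Let $a, b, n$ be integers. Then: (i) $|F_a F_b| < F_n - 1$ if $|a| + |b| \leq n$ and $n \geq 5$; (ii) $|5 F_a F_b| < L_n - 1$ if $|a| + |b| \leq n-1$ and $n \geq 6$; (iii) $|L_a| < L_n - 1$ if $|a| \leq n-1$ and $n \geq 4$; (iv) $|L_a L_b| < L_n - 1$ if $|a| + |b| \leq n-1$, $\{|a|, |b|\} \neq \{0, n-1\}$, and $n \geq 6$.
   Context: Fibonacci and Lucas numbers are defined for all integers $k$ by $F_k = (\alpha^k - \beta^k)/(\alpha - \beta)$ and $L_k = \alpha^k + \beta^k$, where $\alpha = (1+\sqrt5)/2$ and $\beta = (1-\sqrt5)/2$; thus $F_0=0$, $F_1=F_2=1$, $L_0=2$, $L_1=1$, both satisfying $X_{k} = X_{k-1}+X_{k-2}$ for all integers $k$, and $F_{ -k} = (-1)^{k+1}F_k$, $L_{ -k} = (-1)^k L_k$. -}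

module Defs where

open import Data.Nat using (ℕ; zero; suc)
open import Data.Integer using (ℤ; +_; -[1+_]; -_)

fibℕ : ℕ → ℕ
fibℕ 0 = 0
fibℕ 1 = 1
fibℕ (suc (suc k)) = fibℕ (suc k) Data.Nat.+ fibℕ k

lucℕ : ℕ → ℕ
lucℕ 0 = 2
lucℕ 1 = 1
lucℕ (suc (suc k)) = lucℕ (suc k) Data.Nat.+ lucℕ k

signPow : ℕ → ℤ → ℤ
signPow zero x = x
signPow (suc k) x = - signPow k x

-- F_k for integer k, using F_{-k} = (-1)^{k+1} F_k
F : ℤ → ℤ
F (+ k) = + fibℕ k
F -[1+ k ] = signPow (suc (suc k)) (+ fibℕ (suc k))

-- L_k for integer k, using L_{-k} = (-1)^k L_k
L : ℤ → ℤ
L (+ k) = + lucℕ k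
L -[1+ k ] = signPow (suc k) (+ lucℕ (suc k))

{-# OPTIONS --safe #-}
-- Since |F_{-k}| = F_k and |L_{-k}| = L_k, only natural indices matter. The formulas
-- F_{m+n+1} = F_{m+1} F_{n+1} + F_m F_n,  L_{m+1} L_{n+1} + L_m L_n = L_{m+n} + L_{m+n+2}
-- and L_n + L_{n+2} = 5 F_{n+1} (both sides satisfy the Fibonacci recurrence and agree at
-- 0 and 1) bound each product by one or two terms of index below n. Comparing with
-- X_n = X_{n-1} + X_{n-2} leaves a margin that is itself a Fibonacci or Lucas number of
-- large enough index to be at least 2.
module Submission where

open import Defs
open import Data.Product using (_×_; _,_)
import Data.Product as Product
open import Data.Sum using (_⊎_; inj₁; inj₂)
import Data.Sum as Sum
open import Function using (_∘_)
open import Relation.Nullary using (¬_)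
open import Relation.Binary.PropositionalEquality
  using (_≡_; refl; sym; trans; cong; cong₂; subst)

-- ℕ is opened only in this scope, so that the theorem can use the integer operators unqualified.
module _ where
  open import Data.Nat using (ℕ; zero; suc; _+_; _*_; _≤_; _<_; z≤n; s≤s)
  open import Data.Nat.Properties
  open import Data.Nat.Tactic.RingSolver using (solve-∀)
  open import Algebra.Properties.CommutativeSemigroup +-commutativeSemigroup using (interchange)
  open import Relation.Binary.PropositionalEquality using (module ≡-Reasoning)

  private variable
    u v : ℕ → ℕ
    n k s r p x y : ℕ

  record IsFibonacciLike (u : ℕ → ℕ) : Set where
    constructor fibonacciLike
    field recurrence : ∀ k → u (2 + k) ≡ u (1 + k) + u k

  open IsFibonacciLike

  fibℕ-isFibonacciLike : IsFibonacciLike fibℕ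
  fibℕ-isFibonacciLike = fibonacciLike λ _ → refl

  lucℕ-isFibonacciLike : IsFibonacciLike lucℕ
  lucℕ-isFibonacciLike = fibonacciLike λ _ → refl

  fibonacciLike-unique : IsFibonacciLike u → IsFibonacciLike v →
                         u 0 ≡ v 0 → u 1 ≡ v 1 → ∀ k → u k ≡ v k
  fibonacciLike-unique {u} {v} hu hv u₀≡v₀ u₁≡v₁ = go
    where
    open ≡-Reasoning
    go : ∀ k → u k ≡ v k
    go zero          = u₀≡v₀
    go (suc zero)    = u₁≡v₁
    go (suc (suc k)) = begin
      u (2 + k)        ≡⟨ recurrence hu k ⟩
      u (1 + k) + u k  ≡⟨ cong₂ _+_ (go (suc k)) (go k) ⟩
      v (1 + k) + v k  ≡⟨ recurrence hv k ⟨
      v (2 + k)        ∎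

  fibonacciLike-+ : IsFibonacciLike u → IsFibonacciLike v → IsFibonacciLike (λ k → u k + v k)
  fibonacciLike-+ {u} {v} hu hv = fibonacciLike λ k → begin
    u (2 + k) + v (2 + k)                  ≡⟨ cong₂ _+_ (recurrence hu k) (recurrence hv k) ⟩
    (u (1 + k) + u k) + (v (1 + k) + v k)  ≡⟨ interchange (u (1 + k)) (u k) (v (1 + k)) (v k) ⟩
    (u (1 + k) + v (1 + k)) + (u k + v k)  ∎
    where open ≡-Reasoning

  fibonacciLike-* : ∀ c → IsFibonacciLike u → IsFibonacciLike (λ k → u k * c)
  fibonacciLike-* {u} c hu = fibonacciLike λ k →
    trans (cong (_* c) (recurrence hu k)) (*-distribʳ-+ c (u (1 + k)) (u k))

  fibonacciLike-step : IsFibonacciLike u → ∀ k → u (1 + k) ≤ u (2 + k)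
  fibonacciLike-step {u} hu k =
    subst (u (1 + k) ≤_) (sym (recurrence hu k)) (m≤m+n (u (1 + k)) (u k))

  fibonacciLike-mono : IsFibonacciLike u → s ≤ r → u (suc s) ≤ u (suc r)
  fibonacciLike-mono {r = zero}  hu z≤n   = ≤-refl
  fibonacciLike-mono {r = suc r} hu s≤1+r with m≤n⇒m<n∨m≡n s≤1+r
  ... | inj₂ refl  = ≤-refl
  ... | inj₁ s<1+r = ≤-trans (fibonacciLike-mono hu (m<1+n⇒m≤n s<1+r)) (fibonacciLike-step hu r)

  fibonacciLike-gap : IsFibonacciLike u → ∀ k → 2 ≤ u k → p ≤ u (1 + k) → 2 + p ≤ u (2 + k)
  fibonacciLike-gap {u} hu k 2≤uₖ p≤uₖ₊₁ =
    subst (_ ≤_) (trans (+-comm (u k) (u (1 + k))) (sym (recurrence hu k)))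
          (+-mono-≤ 2≤uₖ p≤uₖ₊₁)

  fibℕ-mono : s ≤ r → fibℕ s ≤ fibℕ r
  fibℕ-mono z≤n       = z≤n
  fibℕ-mono (s≤s s≤r) = fibonacciLike-mono fibℕ-isFibonacciLike s≤r

  lucℕ-mono : s ≤ r → 2 ≤ r → lucℕ s ≤ lucℕ r
  lucℕ-mono {suc s} (s≤s s≤r) _   = fibonacciLike-mono lucℕ-isFibonacciLike s≤r
  lucℕ-mono {zero} {suc zero} _ (s≤s ())
  lucℕ-mono {zero} {suc (suc r)} _ _ =
    ≤-trans (n≤1+n 2) (fibonacciLike-mono lucℕ-isFibonacciLike (s≤s (z≤n {r})))

  2≤lucℕ : 2 ≤ k → 2 ≤ lucℕ k
  2≤lucℕ = lucℕ-mono z≤n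

  fibℕ-+ : ∀ m n → fibℕ (suc (m + n)) ≡ fibℕ (suc m) * fibℕ (suc n) + fibℕ m * fibℕ n
  fibℕ-+ m n = fibonacciLike-unique lhs rhs
    (sym (trans (+-identityʳ _) (*-identityˡ (fibℕ (suc n)))))
    (sym (cong₂ _+_ (*-identityˡ (fibℕ (suc n))) (*-identityˡ (fibℕ n))))
    m
    where
    lhs : IsFibonacciLike λ m → fibℕ (suc (m + n))
    lhs = fibonacciLike λ _ → refl
    rhs : IsFibonacciLike λ m → fibℕ (suc m) * fibℕ (suc n) + fibℕ m * fibℕ n
    rhs = fibonacciLike-+ (fibonacciLike-* _ (fibonacciLike {λ k → fibℕ (suc k)} λ _ → refl))
                          (fibonacciLike-* _ fibℕ-isFibonacciLike)

  lucℕ-+-lucℕ≡5*fibℕ : ∀ n → lucℕ n + lucℕ (2 + n) ≡ 5 * fibℕ (suc n)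
  lucℕ-+-lucℕ≡5*fibℕ = fibonacciLike-unique lhs rhs refl refl
    where
    lhs : IsFibonacciLike λ n → lucℕ n + lucℕ (2 + n)
    lhs = fibonacciLike-+ lucℕ-isFibonacciLike (fibonacciLike λ _ → refl)
    rhs : IsFibonacciLike λ n → 5 * fibℕ (suc n)
    rhs = fibonacciLike λ k → *-distribˡ-+ 5 (fibℕ (2 + k)) (fibℕ (1 + k))

  lucℕ-*-+ : ∀ m n →
             lucℕ (suc m) * lucℕ (suc n) + lucℕ m * lucℕ n ≡ lucℕ (m + n) + lucℕ (2 + (m + n))
  lucℕ-*-+ m n = fibonacciLike-unique lhs rhs
    (base₀ (lucℕ (suc n)) (lucℕ n))
    (base₁ (lucℕ (suc n)) (lucℕ n))
    m
    where
    lhs : IsFibonacciLike λ m → lucℕ (suc m) * lucℕ (suc n) + lucℕ m * lucℕ n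
    lhs = fibonacciLike-+ (fibonacciLike-* _ (fibonacciLike {λ k → lucℕ (suc k)} λ _ → refl))
                          (fibonacciLike-* _ lucℕ-isFibonacciLike)
    rhs : IsFibonacciLike λ m → lucℕ (m + n) + lucℕ (2 + (m + n))
    rhs = fibonacciLike-+ {λ m → lucℕ (m + n)} (fibonacciLike λ _ → refl) (fibonacciLike λ _ → refl)
    base₀ : ∀ a b → 1 * a + 2 * b ≡ b + (a + b)
    base₀ = solve-∀
    base₁ : ∀ a b → 3 * a + 1 * b ≡ a + ((a + b) + a)
    base₁ = solve-∀

  fibℕ*fibℕ≤fibℕ : ∀ x y → x + y ≤ suc n → fibℕ x * fibℕ y ≤ fibℕ n
  fibℕ*fibℕ≤fibℕ zero    _       _                 = z≤n
  fibℕ*fibℕ≤fibℕ (suc x) zero    _                 = ≤-trans (≤-reflexive (*-zeroʳ (fibℕ (suc x)))) z≤n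
  fibℕ*fibℕ≤fibℕ {n} (suc x) (suc y) (s≤s x+1+y≤n) = begin
    fibℕ (suc x) * fibℕ (suc y)                    ≤⟨ m≤m+n _ (fibℕ x * fibℕ y) ⟩
    fibℕ (suc x) * fibℕ (suc y) + fibℕ x * fibℕ y  ≡⟨ fibℕ-+ x y ⟨
    fibℕ (suc (x + y))                             ≤⟨ fibℕ-mono (subst (_≤ n) (+-suc x y) x+1+y≤n) ⟩
    fibℕ n                                         ∎
    where open ≤-Reasoning

  lucℕ*lucℕ≤lucℕ+lucℕ : ∀ m n → lucℕ (suc m) * lucℕ (suc n) ≤ lucℕ (m + n) + lucℕ (2 + (m + n))
  lucℕ*lucℕ≤lucℕ+lucℕ m n =
    subst (lucℕ (suc m) * lucℕ (suc n) ≤_) (lucℕ-*-+ m n) (m≤m+n _ (lucℕ m * lucℕ n))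

  2+fibℕ*fibℕ≤fibℕ : ∀ x y → x + y ≤ n → 5 ≤ n → 2 + fibℕ x * fibℕ y ≤ fibℕ n
  2+fibℕ*fibℕ≤fibℕ x y x+y≤n (s≤s (s≤s {n = k} 3≤k)) =
    fibonacciLike-gap fibℕ-isFibonacciLike k (fibℕ-mono 3≤k) (fibℕ*fibℕ≤fibℕ x y x+y≤n)

  2+5*fibℕ*fibℕ≤lucℕ : ∀ x y → x + y ≤ n → 5 ≤ n → 2 + 5 * fibℕ x * fibℕ y ≤ lucℕ (suc n)
  2+5*fibℕ*fibℕ≤lucℕ x y x+y≤n (s≤s (s≤s (s≤s {n = k} 2≤k))) = begin
    2 + 5 * fibℕ x * fibℕ y                ≡⟨ cong (2 +_) (*-assoc 5 (fibℕ x) (fibℕ y)) ⟩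
    2 + 5 * (fibℕ x * fibℕ y)              ≤⟨ +-monoʳ-≤ 2 (*-monoʳ-≤ 5 (fibℕ*fibℕ≤fibℕ x y x+y≤n)) ⟩
    2 + 5 * fibℕ (2 + k)                   ≡⟨ cong (2 +_) (lucℕ-+-lucℕ≡5*fibℕ (1 + k)) ⟨
    2 + (lucℕ (1 + k) + lucℕ (3 + k))      ≤⟨ +-monoˡ-≤ (lucℕ (3 + k))
                                                (fibonacciLike-gap lucℕ-isFibonacciLike k (2≤lucℕ 2≤k) ≤-refl) ⟩
    lucℕ (2 + k) + lucℕ (3 + k)            ≡⟨ +-comm (lucℕ (2 + k)) (lucℕ (3 + k)) ⟩
    lucℕ (4 + k)                           ∎
    where open ≤-Reasoning

  2+lucℕ≤lucℕ : x ≤ n → 3 ≤ n → 2 + lucℕ x ≤ lucℕ (suc n)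
  2+lucℕ≤lucℕ x≤n (s≤s {n = k} 2≤k) =
    fibonacciLike-gap lucℕ-isFibonacciLike k (2≤lucℕ 2≤k) (lucℕ-mono x≤n (m≤n⇒m≤1+n 2≤k))

  2+2*lucℕ≤lucℕ : y < n → 5 ≤ n → 2 + 2 * lucℕ y ≤ lucℕ (suc n)
  2+2*lucℕ≤lucℕ {y} (s≤s y≤2+k) (s≤s (s≤s (s≤s {n = k} 2≤k))) =
    +-mono-≤ (fibonacciLike-gap lucℕ-isFibonacciLike (1 + k) (2≤lucℕ (m≤n⇒m≤1+n 2≤k)) Ly≤L[2+k])
             (≤-trans (≤-reflexive (+-identityʳ (lucℕ y))) Ly≤L[2+k])
    where
    Ly≤L[2+k] : lucℕ y ≤ lucℕ (2 + k)
    Ly≤L[2+k] = lucℕ-mono y≤2+k (m≤m+n 2 k)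

  2+lucℕ*lucℕ≤lucℕ : ∀ x y → x + y ≤ n → ¬ ((x ≡ 0 × y ≡ n) ⊎ (x ≡ n × y ≡ 0)) → 5 ≤ n →
                     2 + lucℕ x * lucℕ y ≤ lucℕ (suc n)
  2+lucℕ*lucℕ≤lucℕ zero y y≤n ¬edge 5≤n =
    2+2*lucℕ≤lucℕ (≤∧≢⇒< y≤n (λ y≡n → ¬edge (inj₁ (refl , y≡n)))) 5≤n
  2+lucℕ*lucℕ≤lucℕ {n} (suc x) zero x+0≤n ¬edge 5≤n =
    subst (λ z → 2 + z ≤ lucℕ (suc n)) (*-comm 2 (lucℕ (suc x)))
      (2+2*lucℕ≤lucℕ (≤∧≢⇒< (subst (_≤ n) (+-identityʳ (suc x)) x+0≤n)
                            (λ x≡n → ¬edge (inj₂ (x≡n , refl))))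
                      5≤n)
  2+lucℕ*lucℕ≤lucℕ (suc x) (suc y) sums≤n _ (s≤s (s≤s (s≤s {n = k} 2≤k))) = begin
    2 + lucℕ (suc x) * lucℕ (suc y)            ≤⟨ +-monoʳ-≤ 2 (lucℕ*lucℕ≤lucℕ+lucℕ x y) ⟩
    2 + (lucℕ (x + y) + lucℕ (2 + (x + y)))    ≤⟨ +-mono-≤ (fibonacciLike-gap lucℕ-isFibonacciLike k (2≤lucℕ 2≤k)
                                                              (lucℕ-mono x+y≤1+k (m≤n⇒m≤1+n 2≤k)))
                                                           (lucℕ-mono 2+x+y≤3+k (m≤m+n 2 (1 + k))) ⟩
    lucℕ (2 + k) + lucℕ (3 + k)                ≡⟨ +-comm (lucℕ (2 + k)) (lucℕ (3 + k)) ⟩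
    lucℕ (4 + k)                               ∎
    where
    open ≤-Reasoning
    2+x+y≤3+k : 2 + (x + y) ≤ 3 + k
    2+x+y≤3+k = subst (_≤ 3 + k) (cong suc (+-suc x y)) sums≤n
    x+y≤1+k : x + y ≤ 1 + k
    x+y≤1+k = ≤-pred (≤-pred 2+x+y≤3+k)

open import Data.Nat using (suc; zero; s≤s)
import Data.Nat as ℕ
open import Data.Integer using (ℤ; +_; -[1+_]; _+_; _-_; _*_; _<_; _≤_; ∣_∣; +≤+; +<+)
open import Data.Integer.Properties using (∣-i∣≡∣i∣; ∣i*j∣≡∣i∣*∣j∣)

2+m≤n⇒+m<+n-1 : ∀ {m n} → 2 ℕ.+ m ℕ.≤ n → + m < + n - + 1
2+m≤n⇒+m<+n-1 {n = suc (suc n)} (s≤s (s≤s m≤n)) = +<+ (s≤s m≤n)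

∣signPow∣ : ∀ k x → ∣ signPow k x ∣ ≡ ∣ x ∣
∣signPow∣ zero    x = refl
∣signPow∣ (suc k) x = trans (∣-i∣≡∣i∣ (signPow k x)) (∣signPow∣ k x)

∣F∣≡fibℕ∣∣ : ∀ a → ∣ F a ∣ ≡ fibℕ ∣ a ∣
∣F∣≡fibℕ∣∣ (+ k)    = refl
∣F∣≡fibℕ∣∣ -[1+ k ] = ∣signPow∣ (2 ℕ.+ k) (+ fibℕ (suc k))

∣L∣≡lucℕ∣∣ : ∀ a → ∣ L a ∣ ≡ lucℕ ∣ a ∣
∣L∣≡lucℕ∣∣ (+ k)    = refl
∣L∣≡lucℕ∣∣ -[1+ k ] = ∣signPow∣ (1 ℕ.+ k) (+ lucℕ (suc k))

∣F*F∣<F-1 : ∀ a b k → + ∣ a ∣ + + ∣ b ∣ ≤ + k → + 5 ≤ + k → + ∣ F a * F b ∣ < F (+ k) - + 1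
∣F*F∣<F-1 a b k (+≤+ h) (+≤+ 5≤k)
  rewrite ∣i*j∣≡∣i∣*∣j∣ (F a) (F b) | ∣F∣≡fibℕ∣∣ a | ∣F∣≡fibℕ∣∣ b =
  2+m≤n⇒+m<+n-1 (2+fibℕ*fibℕ≤fibℕ ∣ a ∣ ∣ b ∣ h 5≤k)

∣5*F*F∣<L-1 : ∀ a b k → + ∣ a ∣ + + ∣ b ∣ ≤ + k - + 1 → + 6 ≤ + k → + ∣ + 5 * F a * F b ∣ < L (+ k) - + 1
∣5*F*F∣<L-1 a b zero    _       (+≤+ ())
∣5*F*F∣<L-1 a b (suc k) (+≤+ h) (+≤+ (s≤s 5≤k))
  rewrite ∣i*j∣≡∣i∣*∣j∣ (+ 5 * F a) (F b) | ∣i*j∣≡∣i∣*∣j∣ (+ 5) (F a) | ∣F∣≡fibℕ∣∣ a | ∣F∣≡fibℕ∣∣ b =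
  2+m≤n⇒+m<+n-1 (2+5*fibℕ*fibℕ≤lucℕ ∣ a ∣ ∣ b ∣ h 5≤k)

∣L∣<L-1 : ∀ a k → + ∣ a ∣ ≤ + k - + 1 → + 4 ≤ + k → + ∣ L a ∣ < L (+ k) - + 1
∣L∣<L-1 a zero    _       (+≤+ ())
∣L∣<L-1 a (suc k) (+≤+ h) (+≤+ (s≤s 3≤k)) rewrite ∣L∣≡lucℕ∣∣ a =
  2+m≤n⇒+m<+n-1 (2+lucℕ≤lucℕ h 3≤k)

∣L*L∣<L-1 : ∀ a b k → + ∣ a ∣ + + ∣ b ∣ ≤ + k - + 1 →
            ¬ ((+ ∣ a ∣ ≡ + 0 × + ∣ b ∣ ≡ + k - + 1) ⊎ (+ ∣ a ∣ ≡ + k - + 1 × + ∣ b ∣ ≡ + 0)) →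
            + 6 ≤ + k → + ∣ L a * L b ∣ < L (+ k) - + 1
∣L*L∣<L-1 a b zero    _       _      (+≤+ ())
∣L*L∣<L-1 a b (suc k) (+≤+ h) ¬edge (+≤+ (s≤s 5≤k))
  rewrite ∣i*j∣≡∣i∣*∣j∣ (L a) (L b) | ∣L∣≡lucℕ∣∣ a | ∣L∣≡lucℕ∣∣ b =
  2+m≤n⇒+m<+n-1 (2+lucℕ*lucℕ≤lucℕ ∣ a ∣ ∣ b ∣ h (¬edge ∘ Sum.map cast cast) 5≤k)
  where
  cast : ∀ {x y x′ y′} → x ≡ x′ × y ≡ y′ → + x ≡ + x′ × + y ≡ + y′
  cast = Product.map (cong (+_)) (cong (+_))

lemma4 : (a b n : ℤ) →
    ((+ ∣ a ∣ + + ∣ b ∣ ≤ n → + 5 ≤ n →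
        + ∣ F a * F b ∣ < F n - + 1)
    × (+ ∣ a ∣ + + ∣ b ∣ ≤ n - + 1 → + 6 ≤ n →
        + ∣ + 5 * F a * F b ∣ < L n - + 1)
    × (+ ∣ a ∣ ≤ n - + 1 → + 4 ≤ n →
        + ∣ L a ∣ < L n - + 1)
    × (+ ∣ a ∣ + + ∣ b ∣ ≤ n - + 1 →
        ¬ ((+ ∣ a ∣ ≡ + 0 × + ∣ b ∣ ≡ n - + 1) ⊎ (+ ∣ a ∣ ≡ n - + 1 × + ∣ b ∣ ≡ + 0)) →
        + 6 ≤ n →
        + ∣ L a * L b ∣ < L n - + 1))
lemma4 a b (+ k)    = ∣F*F∣<F-1 a b k , ∣5*F*F∣<L-1 a b k , ∣L∣<L-1 a k , ∣L*L∣<L-1 a b k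
lemma4 a b -[1+ k ] = (λ _ ()) , (λ _ ()) , (λ _ ()) , (λ _ _ ())
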